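{- Let $k\ge0$ and $n\in\{2^k,2^k+1\}$. Then for every integer $i\ge0$ with $2^i\le n$, the polynomial $1+x^{2^i}$ does not divide $\mathrm{num}_{\mathcal B}(n,x)$.
   Context: $\mathcal B(n)$ is the set of binary partitions of $n$ (all parts powers of $2$) and $m_\lambda(i)$ the number of parts of $\lambda$ equal to $i$. For $\lambda\in\mathcal B(n)$ let $h_{\mathcal B,\lambda}(x)=\prod_{i=0}^{\lfloor\log_2 n\rfloor}(1+x^{2^i})^{\lfloor n/2^i\rfloor-m_\lambda(2^i)}$ and $\mathrm{num}_{\mathcal B}(n,x)=\sum_{\lambda\in\mathcal B(n)}h_{\mathcal B,\lambda}(x)$. -}

module Defs where

open import Data.Nat using (ℕ; zero; suc; _∸_; _^_; ⌊_/2⌋; _≟_)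
import Data.Nat as ℕ
open import Data.Nat.Logarithm using (⌊log₂_⌋)
open import Data.Integer using (ℤ; 0ℤ; 1ℤ; _+_; _*_)
open import Data.List using (List; []; _∷_; map; concatMap; filter; foldr; zipWith)
open import Data.Vec using (Vec; []; _∷_)
open import Data.Product using (Σ; _,_)
open import Relation.Binary.PropositionalEquality using (_≡_)

-- Polynomials in ℤ[x] as little-endian coefficient lists.

Poly : Set
Poly = List ℤ

coeff : Poly → ℕ → ℤ
coeff []       _       = 0ℤ
coeff (a ∷ p)  zero    = a
coeff (a ∷ p)  (suc j) = coeff p j

-- equality of polynomials: equal coefficients (trailing zeros irrelevant)
_≈ₚ_ : Poly → Poly → Set
p ≈ₚ q = ∀ j → coeff p j ≡ coeff q j

_+ₚ_ : Poly → Poly → Poly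
[]      +ₚ q       = q
(a ∷ p) +ₚ []      = a ∷ p
(a ∷ p) +ₚ (b ∷ q) = (a + b) ∷ (p +ₚ q)

scale : ℤ → Poly → Poly
scale c = map (c *_)

_*ₚ_ : Poly → Poly → Poly
[]      *ₚ q = []
(a ∷ p) *ₚ q = scale a q +ₚ (0ℤ ∷ (p *ₚ q))

oneₚ : Poly
oneₚ = 1ℤ ∷ []

_^ₚ_ : Poly → ℕ → Poly
p ^ₚ zero  = oneₚ
p ^ₚ suc e = p *ₚ (p ^ₚ e)

xPow : ℕ → Poly
xPow zero    = 1ℤ ∷ []
xPow (suc m) = 0ℤ ∷ xPow m

onePlusXPow : ℕ → Poly
onePlusXPow m = oneₚ +ₚ xPow m

_∣ₚ_ : Poly → Poly → Set
d ∣ₚ p = Σ Poly (λ q → p ≈ₚ (d *ₚ q))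

sumₚ : List Poly → Poly
sumₚ = foldr _+ₚ_ []

-- Binary partitions of n, represented by their multiplicity vectors
-- (m(2^0), m(2^1), ..., m(2^K)) with K = ⌊log₂ n⌋.

divPow2 : ℕ → ℕ → ℕ
divPow2 n zero    = n
divPow2 n (suc i) = ⌊ divPow2 n i /2⌋

K : ℕ → ℕ
K n = ⌊log₂ n ⌋

upto : ℕ → List ℕ
upto zero    = zero ∷ []
upto (suc b) = zero ∷ map suc (upto b)

boundedVecs : (n j len : ℕ) → List (Vec ℕ len)
boundedVecs n j zero      = [] ∷ []
boundedVecs n j (suc len) =
  concatMap (λ m → map (m ∷_) (boundedVecs n (suc j) len)) (upto (divPow2 n j))

weight : (j : ℕ) → {len : ℕ} → Vec ℕ len → ℕ
weight j []       = 0
weight j (m ∷ ms) = m ℕ.* (2 ^ j) ℕ.+ weight (suc j) ms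

binaryPartitions : (n : ℕ) → List (Vec ℕ (suc (K n)))
binaryPartitions n = filter (λ v → weight 0 v ≟ n) (boundedVecs n 0 (suc (K n)))

hAux : (n j : ℕ) → {len : ℕ} → Vec ℕ len → Poly
hAux n j []       = oneₚ
hAux n j (m ∷ ms) = (onePlusXPow (2 ^ j) ^ₚ (divPow2 n j ∸ m)) *ₚ hAux n (suc j) ms

hB : (n : ℕ) → Vec ℕ (suc (K n)) → Poly
hB n v = hAux n 0 v

numB : ℕ → Poly
numB n = sumₚ (map (hB n) (binaryPartitions n))

-- Evaluate at x = 2. Then 1 + x^(2^i) becomes the Fermat number F_i = 2^(2^i) + 1 and
-- h_λ(2) = ∏_j F_j^(⌊n/2^j⌋ − m_λ(2^j)), so it suffices that F_i does not divide
-- Σ_λ h_λ(2). Write n = q·2^i + r with q = ⌊n/2^i⌋ and r = n mod 2^i; for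
-- n ∈ {2^k, 2^k + 1} we have r ≤ 1, and that is all the hypothesis is used for.
-- If m_λ(2^i) < q then F_i ∣ h_λ(2). Otherwise the remaining parts of λ sum to r ≤ 1,
-- which leaves only λ = (2^i)^q 1^r. Fermat numbers are pairwise coprime and F_i > 1,
-- so F_i does not divide h_λ(2) for that λ, and hence does not divide the sum.
module Submission where

open import Defs
open import Data.Nat using (ℕ; _^_; _≤_; _+_)
open import Data.Sum using (_⊎_)
open import Relation.Nullary using (¬_)
open import Relation.Binary.PropositionalEquality using (_≡_)

open import Data.Nat using (zero; suc; _*_; _∸_; _<_; _≟_; _≤?_; z≤n; s≤s; ⌊_/2⌋; _/_; _%_; NonZero)
open import Data.Nat.Properties
open import Data.Nat.DivMod
  using (m/n≡1+[m∸n]/n; n/1≡n; m/n/o≡m/[n*o]; /-congʳ; m≡m%n+[m/n]*n; m%n≤m; m%n<n; [m+kn]%n≡m%n; n%n≡0)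
open import Data.Nat.Divisibility
  using (_∣_; divides; ∣-trans; ∣-refl; ∣m+n∣m⇒∣n; ∣m∣n⇒∣m+n; _∣0; m∣m*n; n∣m*n; ∣m⇒∣m*n; ∣n⇒∣m*n; ∣1⇒≡1)
open import Data.Nat.Coprimality using (Coprime; coprime-divisor)
import Data.Nat.Coprimality as Coprime
open import Data.Nat.ListAction using (sum)
open import Data.Nat.Logarithm using (⌊log₂⌋-mono-≤; ⌊log₂[2^n]⌋≡n)
open import Data.Nat.Tactic.RingSolver using (solve-∀)
open import Data.Integer as ℤ using (ℤ; 0ℤ)
import Data.Integer.Properties as ℤ
import Data.Integer.Divisibility as ℤ
import Data.Integer.Tactic.RingSolver as ℤ
open import Data.List using (List; []; _∷_; map; filter; upTo; cartesianProductWith; concatMap)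
import Data.List as List
open import Data.List.Properties using (map-applyUpTo)
open import Data.List.Membership.Propositional using (_∈_)
open import Data.List.Membership.Propositional.Properties
  using (∈-cartesianProductWith⁺; ∈-cartesianProductWith⁻; ∈-upTo⁺; ∈-upTo⁻; ∈-filter⁺; ∈-filter⁻)
open import Data.List.Relation.Unary.Any using (here; there)
import Data.List.Relation.Unary.All as All
open import Data.List.Relation.Unary.Unique.Propositional using (Unique; []; _∷_)
import Data.List.Relation.Unary.Unique.Propositional.Properties as Unique
open import Data.Vec as Vec using (Vec; replicate; splitAt; _++_)
open import Data.Vec.Properties using (∷-injective)
open import Data.Product using (_×_; _,_; ∃)
open import Data.Sum using (inj₁; inj₂; [_,_])
open import Function using (id)
open import Relation.Nullary using (contradiction; yes; no)
open import Relation.Binary.Definitions using (tri<; tri≈; tri>)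
open import Relation.Binary.PropositionalEquality
  using (_≢_; ≢-sym; refl; sym; trans; cong; cong₂; subst; subst₂; module ≡-Reasoning)

-- Evaluation at an integer

eval : ℤ → Poly → ℤ
eval x []      = 0ℤ
eval x (a ∷ p) = a ℤ.+ x ℤ.* eval x p

eval-+ₚ : ∀ x p q → eval x (p +ₚ q) ≡ eval x p ℤ.+ eval x q
eval-+ₚ x []      q       = sym (ℤ.+-identityˡ (eval x q))
eval-+ₚ x (a ∷ p) []      = sym (ℤ.+-identityʳ (eval x (a ∷ p)))
eval-+ₚ x (a ∷ p) (b ∷ q) =
  trans (cong (λ s → a ℤ.+ b ℤ.+ x ℤ.* s) (eval-+ₚ x p q)) (regroup a b x (eval x p) (eval x q))
  where
  regroup : ∀ a b x u v → a ℤ.+ b ℤ.+ x ℤ.* (u ℤ.+ v) ≡ a ℤ.+ x ℤ.* u ℤ.+ (b ℤ.+ x ℤ.* v)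
  regroup = ℤ.solve-∀

eval-scale : ∀ x c p → eval x (scale c p) ≡ c ℤ.* eval x p
eval-scale x c []      = sym (ℤ.*-zeroʳ c)
eval-scale x c (a ∷ p) =
  trans (cong (λ s → c ℤ.* a ℤ.+ x ℤ.* s) (eval-scale x c p)) (distrib c a x (eval x p))
  where
  distrib : ∀ c a x u → c ℤ.* a ℤ.+ x ℤ.* (c ℤ.* u) ≡ c ℤ.* (a ℤ.+ x ℤ.* u)
  distrib = ℤ.solve-∀

eval-*ₚ : ∀ x p q → eval x (p *ₚ q) ≡ eval x p ℤ.* eval x q
eval-*ₚ x []      q = sym (ℤ.*-zeroˡ (eval x q))
eval-*ₚ x (a ∷ p) q = begin
  eval x (scale a q +ₚ (0ℤ ∷ (p *ₚ q)))           ≡⟨ eval-+ₚ x (scale a q) (0ℤ ∷ (p *ₚ q)) ⟩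
  eval x (scale a q) ℤ.+ (0ℤ ℤ.+ x ℤ.* eval x (p *ₚ q))
    ≡⟨ cong₂ (λ s t → s ℤ.+ (0ℤ ℤ.+ x ℤ.* t)) (eval-scale x a q) (eval-*ₚ x p q) ⟩
  a ℤ.* eval x q ℤ.+ (0ℤ ℤ.+ x ℤ.* (eval x p ℤ.* eval x q))
    ≡⟨ distrib a x (eval x p) (eval x q) ⟩
  (a ℤ.+ x ℤ.* eval x p) ℤ.* eval x q ∎
  where
  open ≡-Reasoning
  distrib : ∀ a x u v → a ℤ.* v ℤ.+ (0ℤ ℤ.+ x ℤ.* (u ℤ.* v)) ≡ (a ℤ.+ x ℤ.* u) ℤ.* v
  distrib = ℤ.solve-∀

eval-oneₚ : ∀ x → eval x oneₚ ≡ ℤ.1ℤ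
eval-oneₚ x = cong (λ s → ℤ.1ℤ ℤ.+ s) (ℤ.*-zeroʳ x)

eval-^ₚ : ∀ x p e → eval x (p ^ₚ e) ≡ eval x p ℤ.^ e
eval-^ₚ x p zero    = eval-oneₚ x
eval-^ₚ x p (suc e) = trans (eval-*ₚ x p (p ^ₚ e)) (cong (eval x p ℤ.*_) (eval-^ₚ x p e))

eval-zero : ∀ x p → (∀ j → coeff p j ≡ 0ℤ) → eval x p ≡ 0ℤ
eval-zero x []      p≈0 = refl
eval-zero x (a ∷ p) p≈0 = trans (cong₂ (λ b s → b ℤ.+ x ℤ.* s) (p≈0 0) (eval-zero x p (λ j → p≈0 (suc j))))
                                (cong (λ s → 0ℤ ℤ.+ s) (ℤ.*-zeroʳ x))

eval-cong : ∀ x p q → p ≈ₚ q → eval x p ≡ eval x q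
eval-cong x []      q       p≈q = sym (eval-zero x q (λ j → sym (p≈q j)))
eval-cong x (a ∷ p) []      p≈q = eval-zero x (a ∷ p) p≈q
eval-cong x (a ∷ p) (b ∷ q) p≈q =
  cong₂ (λ c s → c ℤ.+ x ℤ.* s) (p≈q 0) (eval-cong x p q (λ j → p≈q (suc j)))

eval-xPow : ∀ x m → eval x (xPow m) ≡ x ℤ.^ m
eval-xPow x zero    = eval-oneₚ x
eval-xPow x (suc m) = trans (ℤ.+-identityˡ _) (cong (x ℤ.*_) (eval-xPow x m))

∣ₚ⇒eval-∣ : ∀ x {d p} → d ∣ₚ p → eval x d ℤ.∣ eval x p
∣ₚ⇒eval-∣ x {d} {p} (q , p≈dq) = divides ℤ.∣ eval x q ∣ (begin
  ℤ.∣ eval x p ∣                    ≡⟨ cong ℤ.∣_∣ (trans (eval-cong x p (d *ₚ q) p≈dq) (eval-*ₚ x d q)) ⟩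
  ℤ.∣ eval x d ℤ.* eval x q ∣        ≡⟨ ℤ.abs-* (eval x d) (eval x q) ⟩
  ℤ.∣ eval x d ∣ * ℤ.∣ eval x q ∣     ≡⟨ *-comm ℤ.∣ eval x d ∣ ℤ.∣ eval x q ∣ ⟩
  ℤ.∣ eval x q ∣ * ℤ.∣ eval x d ∣     ∎)
  where open ≡-Reasoning

pos-^ : ∀ a e → ℤ.+ (a ^ e) ≡ (ℤ.+ a) ℤ.^ e
pos-^ a zero    = refl
pos-^ a (suc e) = trans (ℤ.pos-* a (a ^ e)) (cong (ℤ.+ a ℤ.*_) (pos-^ a e))

eval-sumₚ-map : ∀ x {A : Set} (f : A → Poly) (g : A → ℕ) → (∀ a → eval x (f a) ≡ ℤ.+ g a) →
  ∀ as → eval x (sumₚ (map f as)) ≡ ℤ.+ sum (map g as)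
eval-sumₚ-map x f g f≡g []       = refl
eval-sumₚ-map x f g f≡g (a ∷ as) = begin
  eval x (f a +ₚ sumₚ (map f as))            ≡⟨ eval-+ₚ x (f a) (sumₚ (map f as)) ⟩
  eval x (f a) ℤ.+ eval x (sumₚ (map f as))  ≡⟨ cong₂ ℤ._+_ (f≡g a) (eval-sumₚ-map x f g f≡g as) ⟩
  ℤ.+ g a ℤ.+ ℤ.+ sum (map g as)             ≡⟨ ℤ.pos-+ (g a) (sum (map g as)) ⟨
  ℤ.+ sum (map g (a ∷ as))                   ∎
  where open ≡-Reasoning

m∣m^n : ∀ m {n} → 0 < n → m ∣ m ^ n
m∣m^n m {suc n} _ = m∣m*n (m ^ n)

coprime-1 : ∀ a → Coprime a 1
coprime-1 a = Coprime.sym (Coprime.1-coprimeTo a)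

coprime-* : ∀ {a b c} → Coprime a b → Coprime a c → Coprime a (b * c)
coprime-* ab ac (d∣a , d∣bc) = ac (d∣a , coprime-divisor (λ { (e∣d , e∣b) → ab (∣-trans e∣d d∣a , e∣b) }) d∣bc)

coprime-^ : ∀ {a b} e → Coprime a b → Coprime a (b ^ e)
coprime-^ {a} zero    ab = coprime-1 a
coprime-^     (suc e) ab = coprime-* ab (coprime-^ e ab)

module _ {A : Set} (g : A → ℕ) {d : ℕ} where

  ∣-sum : ∀ xs → (∀ {x} → x ∈ xs → d ∣ g x) → d ∣ sum (map g xs)
  ∣-sum []       _   = d ∣0
  ∣-sum (x ∷ xs) d∣g = ∣m∣n⇒∣m+n (d∣g (here refl)) (∣-sum xs (λ x∈ → d∣g (there x∈)))

  ∣-sum⇒∣-exception : ∀ {a xs} → Unique xs → a ∈ xs → (∀ {x} → x ∈ xs → x ≢ a → d ∣ g x) →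
    d ∣ sum (map g xs) → d ∣ g a
  ∣-sum⇒∣-exception {xs = a ∷ xs} (a∉xs ∷ _) (here refl) d∣g d∣sum =
    ∣m+n∣m⇒∣n (subst (d ∣_) (+-comm (g a) _) d∣sum)
      (∣-sum xs (λ x∈ → d∣g (there x∈) (≢-sym (All.lookup a∉xs x∈))))
  ∣-sum⇒∣-exception {xs = x ∷ xs} (x∉xs ∷ xs!) (there a∈) d∣g d∣sum =
    ∣-sum⇒∣-exception xs! a∈ (λ y∈ → d∣g (there y∈))
      (∣m+n∣m⇒∣n d∣sum (d∣g (here refl) (All.lookup x∉xs a∈)))

-- Fermat numbers

fermat : ℕ → ℕ
fermat t = 1 + 2 ^ 2 ^ t

eval-onePlusXPow : ∀ t → eval (ℤ.+ 2) (onePlusXPow (2 ^ t)) ≡ ℤ.+ fermat t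
eval-onePlusXPow t = begin
  eval (ℤ.+ 2) (oneₚ +ₚ xPow (2 ^ t))            ≡⟨ eval-+ₚ (ℤ.+ 2) oneₚ (xPow (2 ^ t)) ⟩
  eval (ℤ.+ 2) oneₚ ℤ.+ eval (ℤ.+ 2) (xPow (2 ^ t))
    ≡⟨ cong₂ ℤ._+_ (eval-oneₚ (ℤ.+ 2)) (eval-xPow (ℤ.+ 2) (2 ^ t)) ⟩
  ℤ.1ℤ ℤ.+ (ℤ.+ 2) ℤ.^ 2 ^ t                      ≡⟨ cong (λ s → ℤ.1ℤ ℤ.+ s) (pos-^ 2 (2 ^ t)) ⟨
  ℤ.+ fermat t                                   ∎
  where open ≡-Reasoning

1<fermat : ∀ t → 1 < fermat t
1<fermat t = s≤s (m^n>0 2 (2 ^ t))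

x*x∸1≡[x∸1]*[1+x] : ∀ x → 0 < x → x * x ∸ 1 ≡ (x ∸ 1) * (1 + x)
x*x∸1≡[x∸1]*[1+x] (suc e) _ = identity e
  where
  identity : ∀ e → e + e * suc e ≡ e * (2 + e)
  identity = solve-∀

2^2^suc∸1 : ∀ t → 2 ^ 2 ^ suc t ∸ 1 ≡ (2 ^ 2 ^ t ∸ 1) * fermat t
2^2^suc∸1 t = begin
  2 ^ (2 ^ t + (2 ^ t + 0)) ∸ 1     ≡⟨ cong (λ e → 2 ^ (2 ^ t + e) ∸ 1) (+-identityʳ (2 ^ t)) ⟩
  2 ^ (2 ^ t + 2 ^ t) ∸ 1           ≡⟨ cong (_∸ 1) (^-distribˡ-+-* 2 (2 ^ t) (2 ^ t)) ⟩
  2 ^ 2 ^ t * 2 ^ 2 ^ t ∸ 1         ≡⟨ x*x∸1≡[x∸1]*[1+x] (2 ^ 2 ^ t) (m^n>0 2 (2 ^ t)) ⟩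
  (2 ^ 2 ^ t ∸ 1) * fermat t        ∎
  where open ≡-Reasoning

fermat-∣-2^2^∸1 : ∀ j d → fermat j ∣ 2 ^ 2 ^ (d + suc j) ∸ 1
fermat-∣-2^2^∸1 j zero    = subst (fermat j ∣_) (sym (2^2^suc∸1 j)) (n∣m*n (2 ^ 2 ^ j ∸ 1))
fermat-∣-2^2^∸1 j (suc d) =
  subst (fermat j ∣_) (sym (2^2^suc∸1 (d + suc j))) (∣m⇒∣m*n (fermat (d + suc j)) (fermat-∣-2^2^∸1 j d))

fermat≡[2^2^∸1]+2 : ∀ t → fermat t ≡ (2 ^ 2 ^ t ∸ 1) + 2
fermat≡[2^2^∸1]+2 t with 2 ^ 2 ^ t | m^n>0 2 (2 ^ t)
... | suc e | _ = sym (+-comm e 2)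

-- A common divisor of F_i and F_j (j < i) divides F_i − (2^2^i − 1) = 2, and F_j is odd.
fermat-coprime-< : ∀ {i j} → j < i → Coprime (fermat i) (fermat j)
fermat-coprime-< {i} {j} j<i {c} (c∣Fi , c∣Fj) = ∣1⇒≡1 c∣1
  where
  c∣2^2^i∸1 : c ∣ 2 ^ 2 ^ i ∸ 1
  c∣2^2^i∸1 = ∣-trans c∣Fj
    (subst (λ t → fermat j ∣ 2 ^ 2 ^ t ∸ 1) (m∸n+n≡m j<i) (fermat-∣-2^2^∸1 j (i ∸ suc j)))
  c∣2 : c ∣ 2
  c∣2 = ∣m+n∣m⇒∣n (subst (c ∣_) (fermat≡[2^2^∸1]+2 i) c∣Fi) c∣2^2^i∸1
  c∣1 : c ∣ 1
  c∣1 = ∣m+n∣m⇒∣n (subst (c ∣_) (+-comm 1 _) c∣Fj) (∣-trans c∣2 (m∣m^n 2 (m^n>0 2 j)))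

fermat-coprime : ∀ {i j} → i ≢ j → Coprime (fermat i) (fermat j)
fermat-coprime {i} {j} i≢j with <-cmp i j
... | tri< i<j _ _ = Coprime.sym (fermat-coprime-< i<j)
... | tri≈ _ i≡j _ = contradiction i≡j i≢j
... | tri> _ _ j<i = fermat-coprime-< j<i

⌊n/2⌋≡n/2 : ∀ n → ⌊ n /2⌋ ≡ n / 2
⌊n/2⌋≡n/2 zero          = refl
⌊n/2⌋≡n/2 (suc zero)    = refl
⌊n/2⌋≡n/2 (suc (suc n)) = trans (cong suc (⌊n/2⌋≡n/2 n)) (sym (m/n≡1+[m∸n]/n {suc (suc n)} {2} (s≤s (s≤s z≤n))))

divPow2≡/2^ : ∀ n i → divPow2 n i ≡ (n / 2 ^ i) {{m^n≢0 2 i}}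
divPow2≡/2^ n zero    = sym (n/1≡n n)
divPow2≡/2^ n (suc i) = begin
  ⌊ divPow2 n i /2⌋                     ≡⟨ cong ⌊_/2⌋ (divPow2≡/2^ n i) ⟩
  ⌊ n / 2 ^ i /2⌋                       ≡⟨ ⌊n/2⌋≡n/2 (n / 2 ^ i) ⟩
  n / 2 ^ i / 2                         ≡⟨ m/n/o≡m/[n*o] n (2 ^ i) 2 ⟩
  n / (2 ^ i * 2)                       ≡⟨ /-congʳ (*-comm (2 ^ i) 2) ⟩
  n / 2 ^ suc i                         ∎
  where
  open ≡-Reasoning
  instance
    _ = m^n≢0 2 i
    _ = m^n≢0 2 (suc i)
    _ = m*n≢0 (2 ^ i) 2

m<n⇒∃[o]m+suc[o]≡n : ∀ {m n} → m < n → ∃ λ o → m + suc o ≡ n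
m<n⇒∃[o]m+suc[o]≡n {m} m<n with o , 1+m+o≡n ← m≤n⇒∃[o]m+o≡n m<n = o , trans (+-suc m o) 1+m+o≡n

weight-suc : ∀ j {len} (v : Vec ℕ len) → weight (suc j) v ≡ 2 * weight j v
weight-suc j Vec.[]       = refl
weight-suc j (m Vec.∷ ms) =
  trans (cong (m * (2 * 2 ^ j) +_) (weight-suc (suc j) ms)) (distrib m (2 ^ j) (weight (suc j) ms))
  where
  distrib : ∀ m p w → m * (2 * p) + 2 * w ≡ 2 * (m * p + w)
  distrib = solve-∀

weight-++ : ∀ j {a b} (xs : Vec ℕ a) (ys : Vec ℕ b) → weight j (xs ++ ys) ≡ weight j xs + weight (j + a) ys
weight-++ j Vec.[]       ys = cong (λ t → weight t ys) (sym (+-identityʳ j))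
weight-++ j {suc a} (x Vec.∷ xs) ys = begin
  x * 2 ^ j + weight (suc j) (xs ++ ys)                     ≡⟨ cong (x * 2 ^ j +_) (weight-++ (suc j) xs ys) ⟩
  x * 2 ^ j + (weight (suc j) xs + weight (suc j + a) ys)  ≡⟨ sym (+-assoc (x * 2 ^ j) _ _) ⟩
  x * 2 ^ j + weight (suc j) xs + weight (suc j + a) ys
    ≡⟨ cong (λ t → x * 2 ^ j + weight (suc j) xs + weight t ys) (sym (+-suc j a)) ⟩
  x * 2 ^ j + weight (suc j) xs + weight (j + suc a) ys    ∎
  where open ≡-Reasoning

weight-replicate-0 : ∀ j len → weight j (replicate len 0) ≡ 0
weight-replicate-0 j zero      = refl
weight-replicate-0 j (suc len) = weight-replicate-0 (suc j) len

weight≡0⇒replicate-0 : ∀ j {len} (v : Vec ℕ len) → weight j v ≡ 0 → v ≡ replicate len 0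
weight≡0⇒replicate-0 j Vec.[]       _   = refl
weight≡0⇒replicate-0 j (m Vec.∷ ms) w≡0 = cong₂ Vec._∷_
  (m*n≡0⇒m≡0 m (2 ^ j) {{m^n≢0 2 j}} (m+n≡0⇒m≡0 (m * 2 ^ j) w≡0))
  (weight≡0⇒replicate-0 (suc j) ms (m+n≡0⇒n≡0 (m * 2 ^ j) w≡0))

2*n≤1⇒n≡0 : ∀ n → 2 * n ≤ 1 → n ≡ 0
2*n≤1⇒n≡0 zero    _       = refl
2*n≤1⇒n≡0 (suc n) (s≤s h) = contradiction (m+n≡0⇒n≡0 n (n≤0⇒n≡0 h)) λ ()

weight-suc≤1⇒replicate-0 : ∀ j {len} (v : Vec ℕ len) → weight (suc j) v ≤ 1 → v ≡ replicate len 0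
weight-suc≤1⇒replicate-0 j v w≤1 = weight≡0⇒replicate-0 (suc j) v
  (trans (weight-suc j v) (cong (2 *_) (2*n≤1⇒n≡0 (weight j v) (subst (_≤ 1) (weight-suc j v) w≤1))))

-- r parts equal to 1; when len = 0 there is no slot for them and r is dropped.
ones : (len r : ℕ) → Vec ℕ len
ones zero      r = Vec.[]
ones (suc len) r = r Vec.∷ replicate len 0

weight-ones : ∀ len r → r < 2 ^ len → weight 0 (ones len r) ≡ r
weight-ones zero      zero    _         = refl
weight-ones zero      (suc r) (s≤s ())
weight-ones (suc len) r    _ = trans (cong₂ _+_ (*-identityʳ r) (weight-replicate-0 1 len)) (+-identityʳ r)

weight≤1⇒ones : ∀ {len} (v : Vec ℕ len) {r} → weight 0 v ≡ r → r ≤ 1 → v ≡ ones len r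
weight≤1⇒ones Vec.[]       _   _   = refl
weight≤1⇒ones {suc len} (m Vec.∷ ms) {r} w≡r r≤1 = cong₂ Vec._∷_ m≡r ms≡0
  where
  ms≡0 : ms ≡ replicate len 0
  ms≡0 = weight-suc≤1⇒replicate-0 0 ms (≤-trans (m≤n+m (weight 1 ms) (m * 1)) (≤-trans (≤-reflexive w≡r) r≤1))
  m≡r : m ≡ r
  m≡r = begin
    m                    ≡⟨ +-identityʳ m ⟨
    m + 0                ≡⟨ cong₂ _+_ (*-identityʳ m) (trans (cong (weight 1) ms≡0) (weight-replicate-0 1 len)) ⟨
    m * 1 + weight 1 ms  ≡⟨ w≡r ⟩
    r                    ∎
    where open ≡-Reasoning

concatMap-map≡cartesianProductWith : ∀ {A B C : Set} (f : A → B → C) xs ys →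
  concatMap (λ x → map (f x) ys) xs ≡ cartesianProductWith f xs ys
concatMap-map≡cartesianProductWith f []       ys = refl
concatMap-map≡cartesianProductWith f (x ∷ xs) ys =
  cong (map (f x) ys List.++_) (concatMap-map≡cartesianProductWith f xs ys)

upto≡upTo : ∀ b → upto b ≡ upTo (suc b)
upto≡upTo zero    = refl
upto≡upTo (suc b) = cong (0 ∷_) (trans (cong (map suc) (upto≡upTo b)) (map-applyUpTo id suc (suc b)))

boundedVecs-suc : ∀ n j len → boundedVecs n j (suc len) ≡
  cartesianProductWith Vec._∷_ (upTo (suc (divPow2 n j))) (boundedVecs n (suc j) len)
boundedVecs-suc n j len = trans
  (concatMap-map≡cartesianProductWith Vec._∷_ (upto (divPow2 n j)) (boundedVecs n (suc j) len))
  (cong (λ ms → cartesianProductWith Vec._∷_ ms (boundedVecs n (suc j) len)) (upto≡upTo (divPow2 n j)))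

data Bounded (n : ℕ) : ℕ → {len : ℕ} → Vec ℕ len → Set where
  []  : ∀ {j} → Bounded n j Vec.[]
  _∷_ : ∀ {j m len} {ms : Vec ℕ len} → m ≤ divPow2 n j → Bounded n (suc j) ms → Bounded n j (m Vec.∷ ms)

∈-boundedVecs⁻ : ∀ n j {len} {v : Vec ℕ len} → v ∈ boundedVecs n j len → Bounded n j v
∈-boundedVecs⁻ n j {zero}  {Vec.[]} _  = []
∈-boundedVecs⁻ n j {suc len} v∈
  with m , ms , m∈ , ms∈ , refl ←
    ∈-cartesianProductWith⁻ Vec._∷_ (upTo (suc (divPow2 n j))) (boundedVecs n (suc j) len)
      (subst (_ ∈_) (boundedVecs-suc n j len) v∈)
  = ≤-pred (∈-upTo⁻ m∈) ∷ ∈-boundedVecs⁻ n (suc j) ms∈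

∈-boundedVecs⁺ : ∀ n j {len} {v : Vec ℕ len} → Bounded n j v → v ∈ boundedVecs n j len
∈-boundedVecs⁺ n j []                = here refl
∈-boundedVecs⁺ n j {suc len} (m≤ ∷ b) = subst (_ ∈_) (sym (boundedVecs-suc n j len))
  (∈-cartesianProductWith⁺ Vec._∷_ {upTo (suc (divPow2 n j))} {boundedVecs n (suc j) len}
    (∈-upTo⁺ (s≤s m≤)) (∈-boundedVecs⁺ n (suc j) b))

boundedVecs-unique : ∀ n j len → Unique (boundedVecs n j len)
boundedVecs-unique n j zero      = All.[] ∷ []
boundedVecs-unique n j (suc len) = subst Unique (sym (boundedVecs-suc n j len))
  (Unique.cartesianProductWith⁺ Vec._∷_ ∷-injective
    (Unique.upTo⁺ (suc (divPow2 n j))) (boundedVecs-unique n (suc j) len))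

Bounded-++⁺ : ∀ {n j a b} {xs : Vec ℕ a} {ys : Vec ℕ b} →
  Bounded n j xs → Bounded n (j + a) ys → Bounded n j (xs ++ ys)
Bounded-++⁺ {n} {j} {ys = ys} []        b = subst (λ t → Bounded n t ys) (+-identityʳ j) b
Bounded-++⁺ {n} {j} {suc a} {ys = ys} (m≤ ∷ bs) b =
  m≤ ∷ Bounded-++⁺ bs (subst (λ t → Bounded n t ys) (+-suc j a) b)

Bounded-++⁻ʳ : ∀ {n j a b} (xs : Vec ℕ a) {ys : Vec ℕ b} → Bounded n j (xs ++ ys) → Bounded n (j + a) ys
Bounded-++⁻ʳ {n} {j} Vec.[] {ys} b = subst (λ t → Bounded n t ys) (sym (+-identityʳ j)) b
Bounded-++⁻ʳ {n} {j} {suc a} (x Vec.∷ xs) {ys} (_ ∷ b) =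
  subst (λ t → Bounded n t ys) (sym (+-suc j a)) (Bounded-++⁻ʳ xs b)

Bounded-replicate-0 : ∀ n j len → Bounded n j (replicate len 0)
Bounded-replicate-0 n j zero      = []
Bounded-replicate-0 n j (suc len) = z≤n ∷ Bounded-replicate-0 n (suc j) len

Bounded-ones : ∀ {n} len {r} → r ≤ n → Bounded n 0 (ones len r)
Bounded-ones zero      r≤n = []
Bounded-ones {n} (suc len) r≤n = r≤n ∷ Bounded-replicate-0 n 1 len

-- binaryPartitions n is boundedPartitions n (suc (K n)); the length is left general so
-- that it can be rewritten as i + suc l when splitting a partition at index i.
boundedPartitions : (n len : ℕ) → List (Vec ℕ len)
boundedPartitions n len = filter (λ v → weight 0 v ≟ n) (boundedVecs n 0 len)

∈-boundedPartitions⁻ : ∀ {n len} {v : Vec ℕ len} → v ∈ boundedPartitions n len → Bounded n 0 v × weight 0 v ≡ n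
∈-boundedPartitions⁻ {n} {len} v∈
  with v∈vecs , w≡n ← ∈-filter⁻ (λ v → weight 0 v ≟ n) {xs = boundedVecs n 0 len} v∈
  = ∈-boundedVecs⁻ n 0 v∈vecs , w≡n

∈-boundedPartitions⁺ : ∀ {n len} {v : Vec ℕ len} → Bounded n 0 v → weight 0 v ≡ n → v ∈ boundedPartitions n len
∈-boundedPartitions⁺ {n} b w≡n = ∈-filter⁺ (λ v → weight 0 v ≟ n) (∈-boundedVecs⁺ n 0 b) w≡n

boundedPartitions-unique : ∀ n len → Unique (boundedPartitions n len)
boundedPartitions-unique n len = Unique.filter⁺ (λ v → weight 0 v ≟ n) (boundedVecs-unique n 0 len)

hAux₂ : (n j : ℕ) {len : ℕ} → Vec ℕ len → ℕ
hAux₂ n j Vec.[]       = 1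
hAux₂ n j (m Vec.∷ ms) = fermat j ^ (divPow2 n j ∸ m) * hAux₂ n (suc j) ms

eval-hAux : ∀ n j {len} (v : Vec ℕ len) → eval (ℤ.+ 2) (hAux n j v) ≡ ℤ.+ hAux₂ n j v
eval-hAux n j Vec.[]       = eval-oneₚ (ℤ.+ 2)
eval-hAux n j (m Vec.∷ ms) = begin
  eval (ℤ.+ 2) ((onePlusXPow (2 ^ j) ^ₚ e) *ₚ hAux n (suc j) ms)
    ≡⟨ eval-*ₚ (ℤ.+ 2) (onePlusXPow (2 ^ j) ^ₚ e) (hAux n (suc j) ms) ⟩
  eval (ℤ.+ 2) (onePlusXPow (2 ^ j) ^ₚ e) ℤ.* eval (ℤ.+ 2) (hAux n (suc j) ms)
    ≡⟨ cong₂ ℤ._*_ (eval-^ₚ (ℤ.+ 2) (onePlusXPow (2 ^ j)) e) (eval-hAux n (suc j) ms) ⟩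
  eval (ℤ.+ 2) (onePlusXPow (2 ^ j)) ℤ.^ e ℤ.* ℤ.+ hAux₂ n (suc j) ms
    ≡⟨ cong (λ x → x ℤ.^ e ℤ.* ℤ.+ hAux₂ n (suc j) ms) (eval-onePlusXPow j) ⟩
  (ℤ.+ fermat j) ℤ.^ e ℤ.* ℤ.+ hAux₂ n (suc j) ms
    ≡⟨ cong (ℤ._* ℤ.+ hAux₂ n (suc j) ms) (pos-^ (fermat j) e) ⟨
  ℤ.+ (fermat j ^ e) ℤ.* ℤ.+ hAux₂ n (suc j) ms
    ≡⟨ ℤ.pos-* (fermat j ^ e) (hAux₂ n (suc j) ms) ⟨
  ℤ.+ hAux₂ n j (m Vec.∷ ms) ∎
  where
  open ≡-Reasoning
  e = divPow2 n j ∸ m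

hAux₂-++ : ∀ n j {a b} (xs : Vec ℕ a) (ys : Vec ℕ b) →
  hAux₂ n j (xs ++ ys) ≡ hAux₂ n j xs * hAux₂ n (j + a) ys
hAux₂-++ n j Vec.[] ys =
  trans (cong (λ t → hAux₂ n t ys) (sym (+-identityʳ j))) (sym (*-identityˡ (hAux₂ n (j + 0) ys)))
hAux₂-++ n j {suc a} (x Vec.∷ xs) ys = begin
  f * hAux₂ n (suc j) (xs ++ ys)                       ≡⟨ cong (f *_) (hAux₂-++ n (suc j) xs ys) ⟩
  f * (hAux₂ n (suc j) xs * hAux₂ n (suc j + a) ys)   ≡⟨ *-assoc f _ _ ⟨
  f * hAux₂ n (suc j) xs * hAux₂ n (suc j + a) ys
    ≡⟨ cong (λ t → f * hAux₂ n (suc j) xs * hAux₂ n t ys) (+-suc j a) ⟨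
  f * hAux₂ n (suc j) xs * hAux₂ n (j + suc a) ys     ∎
  where
  open ≡-Reasoning
  f = fermat j ^ (divPow2 n j ∸ x)

hAux₂-coprime : ∀ n {i} j {len} (v : Vec ℕ len) → i < j ⊎ j + len ≤ i → Coprime (fermat i) (hAux₂ n j v)
hAux₂-coprime n {i} j Vec.[]       _       = coprime-1 (fermat i)
hAux₂-coprime n {i} j {suc len} (m Vec.∷ ms) outside =
  coprime-* (coprime-^ (divPow2 n j ∸ m) (fermat-coprime (i≢j outside)))
            (hAux₂-coprime n (suc j) ms (outside-suc outside))
  where
  outside-suc : i < j ⊎ j + suc len ≤ i → i < suc j ⊎ suc j + len ≤ i
  outside-suc (inj₁ i<j)       = inj₁ (m<n⇒m<1+n i<j)
  outside-suc (inj₂ j+1+len≤i) = inj₂ (subst (_≤ i) (+-suc j len) j+1+len≤i)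
  i≢j : i < j ⊎ j + suc len ≤ i → i ≢ j
  i≢j (inj₁ i<j)       = <⇒≢ i<j
  i≢j (inj₂ j+1+len≤i) = ≢-sym (<⇒≢ (≤-trans (s≤s (m≤m+n j len)) (subst (_≤ i) (+-suc j len) j+1+len≤i)))

-- Splitting a partition at the part 2^i

module _ (n i : ℕ) where

  private instance
    2^i-nonZero : NonZero (2 ^ i)
    2^i-nonZero = m^n≢0 2 i

  %2^i≤e : ∀ k {e} → e ≤ 1 → n ≡ 2 ^ k + e → 2 ^ i ≤ n → n % 2 ^ i ≤ e
  %2^i≤e k {e} e≤1 n≡2^k+e 2^i≤n with i ≤? k
  ... | yes i≤k = begin
    n % 2 ^ i                           ≡⟨ cong (_% 2 ^ i) n≡e+q*2^i ⟩
    (e + 2 ^ (k ∸ i) * 2 ^ i) % 2 ^ i   ≡⟨ [m+kn]%n≡m%n e (2 ^ (k ∸ i)) (2 ^ i) ⟩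
    e % 2 ^ i                           ≤⟨ m%n≤m e (2 ^ i) ⟩
    e                                   ∎
    where
    open ≤-Reasoning
    n≡e+q*2^i : n ≡ e + 2 ^ (k ∸ i) * 2 ^ i
    n≡e+q*2^i = trans n≡2^k+e (trans (+-comm (2 ^ k) e)
      (cong (λ t → e + t) (trans (cong (2 ^_) (sym (m∸n+n≡m i≤k))) (^-distribˡ-+-* 2 (k ∸ i) i))))
  ... | no i≰k = begin
    n % 2 ^ i      ≡⟨ cong (_% 2 ^ i) (≤-antisym n≤2^i 2^i≤n) ⟩
    2 ^ i % 2 ^ i  ≡⟨ n%n≡0 (2 ^ i) ⟩
    0              ≤⟨ z≤n ⟩
    e              ∎
    where
    open ≤-Reasoning
    n≤2^i : n ≤ 2 ^ i
    n≤2^i = begin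
      n                    ≡⟨ n≡2^k+e ⟩
      2 ^ k + e            ≤⟨ +-monoʳ-≤ (2 ^ k) (≤-trans e≤1 (m^n>0 2 k)) ⟩
      2 ^ k + 2 ^ k        ≡⟨ cong (2 ^ k +_) (+-identityʳ (2 ^ k)) ⟨
      2 ^ suc k            ≤⟨ ^-monoʳ-≤ 2 (≰⇒> i≰k) ⟩
      2 ^ i                ∎

  %2^i≤1 : ∀ k → n ≡ 2 ^ k ⊎ n ≡ 2 ^ k + 1 → 2 ^ i ≤ n → n % 2 ^ i ≤ 1
  %2^i≤1 k (inj₁ n≡2^k)   = λ 2^i≤n → ≤-trans (%2^i≤e k z≤n (trans n≡2^k (sym (+-identityʳ (2 ^ k)))) 2^i≤n) z≤n
  %2^i≤1 k (inj₂ n≡2^k+1) = %2^i≤e k ≤-refl n≡2^k+1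

  divPow2-divMod : n ≡ divPow2 n i * 2 ^ i + n % 2 ^ i
  divPow2-divMod = begin
    n                                ≡⟨ m≡m%n+[m/n]*n n (2 ^ i) ⟩
    n % 2 ^ i + n / 2 ^ i * 2 ^ i    ≡⟨ +-comm (n % 2 ^ i) _ ⟩
    n / 2 ^ i * 2 ^ i + n % 2 ^ i    ≡⟨ cong (λ q → q * 2 ^ i + n % 2 ^ i) (divPow2≡/2^ n i) ⟨
    divPow2 n i * 2 ^ i + n % 2 ^ i  ∎
    where open ≡-Reasoning

  -- The partition (2^i)^⌊n/2^i⌋ 1^(n mod 2^i).
  saturated : (l : ℕ) → Vec ℕ (i + suc l)
  saturated l = ones i (n % 2 ^ i) ++ divPow2 n i Vec.∷ replicate l 0

  weight-saturated : ∀ l → weight 0 (saturated l) ≡ n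
  weight-saturated l = begin
    weight 0 (saturated l)
      ≡⟨ weight-++ 0 (ones i r) (B Vec.∷ replicate l 0) ⟩
    weight 0 (ones i r) + (B * 2 ^ i + weight (suc i) (replicate l 0))
      ≡⟨ cong₂ (λ a b → a + (B * 2 ^ i + b)) (weight-ones i r (m%n<n n (2 ^ i))) (weight-replicate-0 (suc i) l) ⟩
    r + (B * 2 ^ i + 0)
      ≡⟨ trans (cong (r +_) (+-identityʳ (B * 2 ^ i))) (+-comm r (B * 2 ^ i)) ⟩
    B * 2 ^ i + r
      ≡⟨ divPow2-divMod ⟨
    n ∎
    where
    open ≡-Reasoning
    B = divPow2 n i
    r = n % 2 ^ i

  Bounded-saturated : ∀ l → Bounded n 0 (saturated l)
  Bounded-saturated l = Bounded-++⁺ (Bounded-ones i (m%n≤m n (2 ^ i))) (≤-refl ∷ Bounded-replicate-0 n (suc i) l)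

  saturated-unique : n % 2 ^ i ≤ 1 → ∀ {l} (pre : Vec ℕ i) (post : Vec ℕ l) →
    weight 0 (pre ++ divPow2 n i Vec.∷ post) ≡ n → pre ++ divPow2 n i Vec.∷ post ≡ saturated l
  saturated-unique r≤1 {l} pre post w≡n = cong₂ _++_ pre≡ones (cong (B Vec.∷_) post≡0)
    where
    B = divPow2 n i
    r = n % 2 ^ i
    Q = B * 2 ^ i
    rest≡r : weight 0 pre + weight (suc i) post ≡ r
    rest≡r = +-cancelˡ-≡ Q _ _ (begin
      Q + (weight 0 pre + weight (suc i) post)  ≡⟨ swap Q (weight 0 pre) (weight (suc i) post) ⟩
      weight 0 pre + (Q + weight (suc i) post)  ≡⟨ weight-++ 0 pre (B Vec.∷ post) ⟨
      weight 0 (pre ++ B Vec.∷ post)            ≡⟨ trans w≡n divPow2-divMod ⟩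
      Q + r                                     ∎)
      where
      open ≡-Reasoning
      swap : ∀ x y z → x + (y + z) ≡ y + (x + z)
      swap = solve-∀
    post≡0 : post ≡ replicate l 0
    post≡0 = weight-suc≤1⇒replicate-0 i post (≤-trans (m≤n+m _ (weight 0 pre)) (≤-trans (≤-reflexive rest≡r) r≤1))
    weight-pre≡r : weight 0 pre ≡ r
    weight-pre≡r = begin
      weight 0 pre                                   ≡⟨ +-identityʳ (weight 0 pre) ⟨
      weight 0 pre + 0                               ≡⟨ cong (weight 0 pre +_) (weight-replicate-0 (suc i) l) ⟨
      weight 0 pre + weight (suc i) (replicate l 0)
        ≡⟨ cong (λ w → weight 0 pre + weight (suc i) w) post≡0 ⟨
      weight 0 pre + weight (suc i) post             ≡⟨ rest≡r ⟩
      r                                              ∎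
      where open ≡-Reasoning
    pre≡ones : pre ≡ ones i r
    pre≡ones = weight≤1⇒ones pre weight-pre≡r r≤1

  fermat-∣-hAux₂ : ∀ {l m} (pre : Vec ℕ i) (post : Vec ℕ l) → m < divPow2 n i →
    fermat i ∣ hAux₂ n 0 (pre ++ m Vec.∷ post)
  fermat-∣-hAux₂ {l} {m} pre post m<B = subst (fermat i ∣_) (sym (hAux₂-++ n 0 pre (m Vec.∷ post)))
    (∣n⇒∣m*n (hAux₂ n 0 pre) (∣m⇒∣m*n (hAux₂ n (suc i) post) (m∣m^n (fermat i) (m<n⇒0<n∸m m<B))))

  hAux₂-saturated-coprime : ∀ l → Coprime (fermat i) (hAux₂ n 0 (saturated l))
  hAux₂-saturated-coprime l = subst (Coprime (fermat i)) (sym (hAux₂-++ n 0 (ones i r) (B Vec.∷ replicate l 0)))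
    (coprime-* (hAux₂-coprime n 0 (ones i r) (inj₂ ≤-refl))
      (coprime-* (subst (λ e → Coprime (fermat i) (fermat i ^ e)) (sym (n∸n≡0 B)) (coprime-1 (fermat i)))
                 (hAux₂-coprime n (suc i) (replicate l 0) (inj₁ ≤-refl))))
    where
    B = divPow2 n i
    r = n % 2 ^ i

  fermat-∣-or-saturated : n % 2 ^ i ≤ 1 → ∀ {l} {v : Vec ℕ (i + suc l)} → v ∈ boundedPartitions n (i + suc l) →
    fermat i ∣ hAux₂ n 0 v ⊎ v ≡ saturated l
  fermat-∣-or-saturated r≤1 {l} {v} v∈
    with pre , m Vec.∷ post , refl ← splitAt i v
    with bounded , w≡n ← ∈-boundedPartitions⁻ v∈
    with m≤B ∷ _ ← Bounded-++⁻ʳ pre bounded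
    with m≤n⇒m<n∨m≡n m≤B
  ... | inj₁ m<B  = inj₁ (fermat-∣-hAux₂ pre post m<B)
  ... | inj₂ refl = inj₂ (saturated-unique r≤1 pre post w≡n)

  fermat-∤-sum-hAux₂ : n % 2 ^ i ≤ 1 → ∀ len → i < len →
    ¬ fermat i ∣ sum (map (hAux₂ n 0) (boundedPartitions n len))
  fermat-∤-sum-hAux₂ r≤1 len i<len F∣sum
    with l , refl ← m<n⇒∃[o]m+suc[o]≡n i<len
    = <⇒≢ (1<fermat i) (sym (hAux₂-saturated-coprime l (∣-refl , F∣saturated)))
    where
    F∣others : ∀ {v} → v ∈ boundedPartitions n (i + suc l) → v ≢ saturated l → fermat i ∣ hAux₂ n 0 v
    F∣others v∈ v≢sat = [ id , (λ v≡sat → contradiction v≡sat v≢sat) ] (fermat-∣-or-saturated r≤1 v∈)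
    F∣saturated : fermat i ∣ hAux₂ n 0 (saturated l)
    F∣saturated = ∣-sum⇒∣-exception (hAux₂ n 0) (boundedPartitions-unique n (i + suc l))
      (∈-boundedPartitions⁺ (Bounded-saturated l) (weight-saturated l)) F∣others F∣sum

theorem4p18 : (k n : ℕ) → (n ≡ 2 ^ k ⊎ n ≡ 2 ^ k + 1) →
    (i : ℕ) → 2 ^ i ≤ n → ¬ (onePlusXPow (2 ^ i) ∣ₚ numB n)
theorem4p18 k n n≡2^k⊎2^k+1 i 2^i≤n 1+x^2^i∣numB =
  fermat-∤-sum-hAux₂ n i (%2^i≤1 n i k n≡2^k⊎2^k+1 2^i≤n) (suc (K n)) (s≤s i≤K) fermat∣sum
  where
  i≤K : i ≤ K n
  i≤K = subst (_≤ K n) (⌊log₂[2^n]⌋≡n i) (⌊log₂⌋-mono-≤ 2^i≤n)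
  fermat∣sum : fermat i ∣ sum (map (hAux₂ n 0) (binaryPartitions n))
  fermat∣sum = subst₂ (λ a b → ℤ.∣ a ∣ ∣ ℤ.∣ b ∣)
    (eval-onePlusXPow i) (eval-sumₚ-map (ℤ.+ 2) (hB n) (hAux₂ n 0) (eval-hAux n 0) (binaryPartitions n))
    (∣ₚ⇒eval-∣ (ℤ.+ 2) {onePlusXPow (2 ^ i)} {numB n} 1+x^2^i∣numB)
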